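{- Let $0\le a<b$ be integers and let $C$ be a cycle of length $b$. Then there exists a set $U\subseteq E(C)$ with $|U|=a$ such that for every arc (path) $A\subseteq C$, $$|E(A)\cap U|\le |E(A)|\,\frac{a}{b}+1.$$ -}

module Defs where

open import Data.Nat using (ℕ; zero; suc; _+_)
open import Data.Nat.DivMod using (_mod_)
open import Data.Fin using (Fin; toℕ)
open import Data.Fin.Subset using (Subset)
open import Data.Vec using (lookup)
open import Data.Bool using (if_then_else_)

-- The cycle C of length b has vertices 0..b-1 and edges e_0..e_{b-1},
-- where e_i joins vertex i and vertex (i+1) mod b.  An arc (path) A ⊆ C is determined by its first
-- edge s and its number of edges ℓ: E(A) = { e_{(s+j) mod b} : j < ℓ }.

arcEdge : ∀ {b} → Fin b → ℕ → Fin b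
arcEdge {suc b} s j = (toℕ s + j) mod (suc b)

arcCount : ∀ {b} → Subset b → Fin b → ℕ → ℕ
arcCount U s zero = 0
arcCount U s (suc ℓ) = arcCount U s ℓ + (if lookup U (arcEdge s ℓ) then 1 else 0)

{-# OPTIONS --safe #-}
module Submission where

-- Let U be the set of edges e_i at which f(i) = ⌊i a / b⌋ increases.  Since a ≤ b,
-- f increases by 0 or 1 at each step, and since f(i + b) = f(i) + a, membership
-- depends only on i mod b and U has f(b) − f(0) = a elements.  On an arc with first
-- edge s and ℓ edges the count telescopes to f(s + ℓ) − f(s), which is less than
-- ℓ a / b + 1 because x − 1 < ⌊x⌋ ≤ x.

open import Defs
open import Data.Nat using (ℕ; zero; suc; _+_; _*_; _∸_; _≤_; _<_; _<ᵇ_; _/_; _%_; z≤n; s≤s; NonZero)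
open import Data.Nat.Properties
open import Data.Nat.DivMod
open import Data.Nat.Divisibility using (∣-refl; n∣m*n)
open import Data.Nat.Tactic.RingSolver using (solve-∀)
open import Data.Fin using (Fin; toℕ)
open import Data.Fin.Properties using (toℕ-fromℕ<)
open import Data.Fin.Subset using (Subset; ∣_∣)
open import Data.Vec using (_∷_; tabulate; lookup)
open import Data.Vec.Properties using (tabulate-cong; lookup∘tabulate)
open import Data.Bool using (Bool; true; false; if_then_else_)
open import Data.Product using (Σ; _×_; _,_)
open import Relation.Binary.PropositionalEquality
  using (_≡_; refl; sym; trans; cong; cong₂; module ≡-Reasoning)

indicator : Bool → ℕ
indicator b = if b then 1 else 0

∣x∷p∣≡indicator[x]+∣p∣ : ∀ {n} x (p : Subset n) → ∣ x ∷ p ∣ ≡ indicator x + ∣ p ∣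
∣x∷p∣≡indicator[x]+∣p∣ true  p = refl
∣x∷p∣≡indicator[x]+∣p∣ false p = refl

indicator[0<ᵇn]≡n : ∀ {n} → n ≤ 1 → indicator (0 <ᵇ n) ≡ n
indicator[0<ᵇn]≡n z≤n       = refl
indicator[0<ᵇn]≡n (s≤s z≤n) = refl

[n+m]/o≤1+m/o : ∀ m {n o} .{{_ : NonZero o}} → n ≤ o → (n + m) / o ≤ suc (m / o)
[n+m]/o≤1+m/o m {n} {o} n≤o = begin
  (n + m) / o     ≤⟨ /-monoˡ-≤ o (+-monoˡ-≤ m n≤o) ⟩
  (o + m) / o     ≡⟨ +-distrib-/-∣ˡ m ∣-refl ⟩
  o / o + m / o   ≡⟨ cong (_+ m / o) (n/n≡1 o) ⟩
  suc (m / o)     ∎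
  where open ≤-Reasoning

[m+n*o]/o≡m/o+n : ∀ m n o .{{_ : NonZero o}} → (m + n * o) / o ≡ m / o + n
[m+n*o]/o≡m/o+n m n o = trans (+-distrib-/-∣ʳ m (n∣m*n n)) (cong (m / o +_) (m*n/n≡m n o))

m/d+c≡[m+k]/d⇒d*c<k+d : ∀ m k d {c} .{{_ : NonZero d}} → m / d + c ≡ (m + k) / d → d * c < k + d
m/d+c≡[m+k]/d⇒d*c<k+d m k d {c} eq = +-cancelˡ-< (d * (m / d)) (d * c) (k + d) (begin-strict
  d * (m / d) + d * c               ≡⟨ sym (*-distribˡ-+ d (m / d) c) ⟩
  d * (m / d + c)                   ≡⟨ cong (d *_) eq ⟩
  d * ((m + k) / d)                 ≡⟨ *-comm d _ ⟩
  (m + k) / d * d                   ≤⟨ m/n*n≤m (m + k) d ⟩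
  m + k                             ≡⟨ cong (_+ k) (m≡m%n+[m/n]*n m d) ⟩
  m % d + m / d * d + k             <⟨ +-monoˡ-< k (+-monoˡ-< (m / d * d) (m%n<n m d)) ⟩
  d + m / d * d + k                 ≡⟨ rearrange d (m / d) k ⟩
  d * (m / d) + (k + d)             ∎)
  where
  open ≤-Reasoning
  rearrange : ∀ d q k → d + q * d + k ≡ d * q + (k + d)
  rearrange = solve-∀

module UnitSteps (g : ℕ → ℕ) (g-mono : ∀ i → g i ≤ g (suc i)) (g-unit : ∀ i → g (suc i) ≤ 1 + g i) where

  rise : ℕ → ℕ
  rise i = g (suc i) ∸ g i

  ascent : ℕ → Bool
  ascent i = 0 <ᵇ rise i

  ascent-step : ∀ i → g i + indicator (ascent i) ≡ g (suc i)
  ascent-step i = trans (cong (g i +_) (indicator[0<ᵇn]≡n (m≤n+o⇒m∸n≤o (g (suc i)) (g i) g[1+i]≤g[i]+1)))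
                        (m+[n∸m]≡n (g-mono i))
    where
    g[1+i]≤g[i]+1 : g (suc i) ≤ g i + 1
    g[1+i]≤g[i]+1 = ≤-trans (g-unit i) (≤-reflexive (+-comm 1 (g i)))

  ascentsFrom : ℕ → (m : ℕ) → Subset m
  ascentsFrom c m = tabulate (λ k → ascent (c + toℕ k))

  ∣ascentsFrom∣-telescopes : ∀ c m → g c + ∣ ascentsFrom c m ∣ ≡ g (c + m)
  ∣ascentsFrom∣-telescopes c zero    = trans (+-identityʳ (g c)) (cong g (sym (+-identityʳ c)))
  ∣ascentsFrom∣-telescopes c (suc m) = begin
    g c + ∣ ascent (c + 0) ∷ rest ∣
      ≡⟨ cong (g c +_) (∣x∷p∣≡indicator[x]+∣p∣ (ascent (c + 0)) rest) ⟩
    g c + (indicator (ascent (c + 0)) + ∣ rest ∣)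
      ≡⟨ cong₂ (λ i (p : Subset m) → g c + (indicator (ascent i) + ∣ p ∣))
               (+-identityʳ c) (tabulate-cong (λ k → cong ascent (+-suc c (toℕ k)))) ⟩
    g c + (indicator (ascent c) + ∣ ascentsFrom (suc c) m ∣)
      ≡⟨ sym (+-assoc (g c) _ _) ⟩
    g c + indicator (ascent c) + ∣ ascentsFrom (suc c) m ∣
      ≡⟨ cong (_+ ∣ ascentsFrom (suc c) m ∣) (ascent-step c) ⟩
    g (suc c) + ∣ ascentsFrom (suc c) m ∣
      ≡⟨ ∣ascentsFrom∣-telescopes (suc c) m ⟩
    g (suc c + m)
      ≡⟨ cong g (sym (+-suc c m)) ⟩
    g (c + suc m) ∎
    where
    open ≡-Reasoning
    rest : Subset m
    rest = tabulate (λ k → ascent (c + suc (toℕ k)))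

  arcCount-telescopes : ∀ {n} (U : Subset (suc n)) → (∀ j → lookup U (j mod suc n) ≡ ascent j) →
                        ∀ s ℓ → g (toℕ s) + arcCount U s ℓ ≡ g (toℕ s + ℓ)
  arcCount-telescopes U U≡ascents s zero    = trans (+-identityʳ _) (cong g (sym (+-identityʳ (toℕ s))))
  arcCount-telescopes {n} U U≡ascents s (suc ℓ) = begin
    g x + (arcCount U s ℓ + indicator (lookup U ((x + ℓ) mod suc n)))
      ≡⟨ sym (+-assoc (g x) _ _) ⟩
    g x + arcCount U s ℓ + indicator (lookup U ((x + ℓ) mod suc n))
      ≡⟨ cong₂ (λ y b → y + indicator b) (arcCount-telescopes U U≡ascents s ℓ) (U≡ascents (x + ℓ)) ⟩
    g (x + ℓ) + indicator (ascent (x + ℓ))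
      ≡⟨ ascent-step (x + ℓ) ⟩
    g (suc (x + ℓ))
      ≡⟨ cong g (sym (+-suc x ℓ)) ⟩
    g (x + suc ℓ) ∎
    where
    open ≡-Reasoning
    x = toℕ s

module FloorLine (n a : ℕ) (a≤N : a ≤ suc n) where

  N : ℕ
  N = suc n

  f : ℕ → ℕ
  f i = i * a / N

  f-mono : ∀ i → f i ≤ f (suc i)
  f-mono i = /-monoˡ-≤ N (m≤n+m (i * a) a)

  f-unit : ∀ i → f (suc i) ≤ 1 + f i
  f-unit i = [n+m]/o≤1+m/o (i * a) a≤N

  f-shift : ∀ x q → f (x + q * N) ≡ f x + q * a
  f-shift x q = trans (cong (_/ N) (distrib x q N a)) ([m+n*o]/o≡m/o+n (x * a) (q * a) N)
    where
    distrib : ∀ x q N a → (x + q * N) * a ≡ x * a + q * a * N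
    distrib = solve-∀

  open UnitSteps f f-mono f-unit

  ascent-periodic : ∀ i → ascent (i % N) ≡ ascent i
  ascent-periodic i = cong (0 <ᵇ_) (begin
    rise r                                ≡⟨ sym ([m+n]∸[m+o]≡n∸o (q * a) (f (suc r)) (f r)) ⟩
    (q * a + f (suc r)) ∸ (q * a + f r)   ≡⟨ cong₂ _∸_ (+-comm (q * a) _) (+-comm (q * a) _) ⟩
    (f (suc r) + q * a) ∸ (f r + q * a)   ≡⟨ sym (cong₂ _∸_ (f-shift (suc r) q) (f-shift r q)) ⟩
    rise (r + q * N)                      ≡⟨ cong rise (sym (m≡m%n+[m/n]*n i N)) ⟩
    rise i                                ∎)
    where
    open ≡-Reasoning
    r = i % N
    q = i / N

  U : Subset N
  U = ascentsFrom 0 N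

  U≡ascents : ∀ j → lookup U (j mod N) ≡ ascent j
  U≡ascents j = trans (lookup∘tabulate (λ k → ascent (toℕ k)) (j mod N))
                      (trans (cong ascent (toℕ-fromℕ< (m%n<n j N))) (ascent-periodic j))

  ∣U∣≡a : ∣ U ∣ ≡ a
  ∣U∣≡a = begin
    ∣ U ∣          ≡⟨ ∣ascentsFrom∣-telescopes 0 N ⟩
    N * a / N      ≡⟨ cong (_/ N) (*-comm N a) ⟩
    a * N / N      ≡⟨ m*n/n≡m a N ⟩
    a              ∎
    where open ≡-Reasoning

  arcCount-U-bound : ∀ s ℓ → N * arcCount U s ℓ ≤ ℓ * a + N
  arcCount-U-bound s ℓ = <⇒≤ (m/d+c≡[m+k]/d⇒d*c<k+d (toℕ s * a) (ℓ * a) N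
    (trans (arcCount-telescopes U U≡ascents s ℓ) (cong (_/ N) (*-distribʳ-+ a (toℕ s) ℓ))))

claim2p1 : (a b : ℕ) → a < b →
    Σ (Subset b) λ U → (∣ U ∣ ≡ a) ×
    ((s : Fin b) (ℓ : ℕ) → ℓ < b → b * arcCount U s ℓ ≤ ℓ * a + b)
-- The bound holds for arcs of every length.
claim2p1 a (suc n) a<b = U , ∣U∣≡a , λ s ℓ _ → arcCount-U-bound s ℓ
  where open FloorLine n a (<⇒≤ a<b)
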